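{- Every simple polygraphic program terminates, i.e. there is no infinite sequence of rewriting steps $f_0\to f_1\to f_2\to\cdots$ on its $2$-paths (using its structure and computation $3$-cells).
   Context: A monoidal $3$-polygraph consists of: $1$-cells (sorts); $1$-paths = finite words of $1$-cells (concatenation $\star_0$, empty word $\ast$); $2$-cells $\phi:s_1(\phi)\Rightarrow t_1(\phi)$ between $1$-paths ($m$ inputs, $n$ outputs = lengths of source and target); $2$-paths = morphisms of the free strict monoidal category generated by $1$- and $2$-cells (circuits modulo deformation), with sequential composition $\star_1$ and parallel composition $\star_0$; and $3$-cells $\alpha:s_2(\alpha)\Rrightarrow t_2(\alpha)$ between parallel $2$-paths. A rewriting step replaces an occurrence of $s_2(\alpha)$ in a $2$-path (in a context $h\star_1(x\star_0 s_2(\alpha)\star_0 y)\star_1 k$) by $t_2(\alpha)$. A polygraphic program is such a polygraph whose $2$-cells are: structure $2$-cells $\tau_{\xi,\zeta}:\xi\star_0\zeta\Rightarrow\zeta\star_0\xi$, $\delta_\xi:\xi\Rightarrow\xi\star_0\xi$, $\varepsilon_\xi:\xi\Rightarrow\ast$ (for all $1$-cells $\xi,\zeta$); constructors (a single $1$-cell as $1$-target); functions (other $2$-cells). Its $3$-cells are structure $3$-cells, for every constructor $\gamma:x\Rightarrow\xi$ and $1$-cell $\zeta$: $(\gamma\star_0\zeta)\star_1\tau_{\xi,\zeta}\Rrightarrow\tau_{x,\zeta}\star_1(\zeta\star_0\gamma)$, $(\zeta\star_0\gamma)\star_1\tau_{\zeta,\xi}\Rrightarrow\tau_{\zeta,x}\star_1(\gamma\star_0\zeta)$,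 $\gamma\star_1\delta_\xi\Rrightarrow\delta_x\star_1(\gamma\star_0\gamma)$, $\gamma\star_1\varepsilon_\xi\Rrightarrow\varepsilon_x$ ($\tau,\delta,\varepsilon$ extended to $1$-paths by structural induction), and computation $3$-cells whose $2$-source is $t\star_1\phi$ with $\phi$ a function and $t$ built only from $1$-cells and constructors. A polygraphic interpretation assigns to each $2$-path $f$ with $m$ inputs and $n$ outputs two monotone (componentwise nondecreasing) maps $f_*:\mathbb{N}^m\to\mathbb{N}^n$ and $[f]:\mathbb{N}^m\to\mathbb{N}$ such that: for a $1$-path $x$ of length $n$, $x_*=\mathrm{id}_{\mathbb{N}^n}$ and $[x]=0$; $(f\star_0 g)_*(\vec x,\vec y)=(f_*(\vec x),g_*(\vec y))$, $[f\star_0 g](\vec x,\vec y)=[f](\vec x)+[g](\vec y)$; $(f\star_1 g)_*(\vec x)=g_*(f_*(\vec x))$, $[f\star_1 g](\vec x)=[f](\vec x)+[g](f_*(\vec x))$. Write $\phi^j_*$ for the $j$-th component of $\phi_*$. It is compatible with a $3$-cell $\alpha$ when $s_2(\alpha)_*(\vec i)\ge t_2(\alpha)_*(\vec i)$ componentwise and $[s_2(\alpha)](\vec i)>[t_2(\alpha)](\vec i)$ for all $\vec i$. An interpretation is simple if: for every $2$-cell $\phi$ with $m$ inputs and $n$ outputs, $\sum_{j=1}^n\phi^j_*$ and $[\phi]$ are polynomials in $\mathbb{N}[x_1,\dots,x_m]$; for every constructor $\gamma$ with $m$ inputs, $\gamma_*=\sum_{i=1}^m x_i+a_\gamma$ with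 $a_\gamma>0$, $[\gamma]=0$, and some $a\in\mathbb{N}^*$ bounds all $a_\gamma$; $(\tau_{\xi,\zeta})_*(i,j)=(j,i)$, $(\delta_\xi)_*(i)=(i,i)$ and $[\tau]=[\delta]=[\varepsilon]=0$; for every function $\phi$ with $m$ inputs and $n$ outputs, $\sum_{j=1}^n\phi^j_*(i_1,\dots,i_m)\ge i_1+\cdots+i_m$. A polygraphic program is simple when there is a constant $K$ such that the $2$-target of each computation $3$-cell contains at most $K$ structure $2$-cells, and it admits a simple interpretation compatible with all of its computation $3$-cells. -}

module Defs where

open import Data.Nat using (ℕ; zero; suc; _+_; _*_; _≤_; _<_)
open import Data.Nat.Properties using ()
open import Data.Fin using (Fin; zero; suc)
open import Data.List using (List; []; _∷_; _++_; [_]; length)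
open import Data.List.Properties using (++-assoc)
open import Data.Product using (Σ; ∃; _×_; _,_; proj₁; proj₂)
open import Data.Empty using (⊥)
open import Data.Unit using (⊤; tt)
open import Relation.Nullary using (¬_)
open import Relation.Binary.PropositionalEquality using (_≡_; subst)

-- Vectors of naturals indexed by a 1-path (one entry per 1-cell):
-- NV x represents ℕ^(length x).

data NV {A : Set} : List A → Set where
  []  : NV []
  _∷_ : ∀ {s xs} → ℕ → NV xs → NV (s ∷ xs)

infixr 5 _∷_

_++ᵛ_ : ∀ {A : Set} {xs ys : List A} → NV xs → NV ys → NV (xs ++ ys)
[] ++ᵛ v = v
(i ∷ u) ++ᵛ v = i ∷ (u ++ᵛ v)

splitᵛ : ∀ {A : Set} (xs : List A) {ys : List A} → NV (xs ++ ys) → NV xs × NV ys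
splitᵛ [] v = [] , v
splitᵛ (_ ∷ xs) (i ∷ v) with splitᵛ xs v
... | u , w = (i ∷ u) , w

sumᵛ : ∀ {A : Set} {xs : List A} → NV xs → ℕ
sumᵛ [] = 0
sumᵛ (i ∷ v) = i + sumᵛ v

lookupᵛ : ∀ {A : Set} {xs : List A} → NV xs → Fin (length xs) → ℕ
lookupᵛ (i ∷ v) zero = i
lookupᵛ (i ∷ v) (suc k) = lookupᵛ v k

data _≤ᵛ_ {A : Set} : ∀ {xs : List A} → NV xs → NV xs → Set where
  []  : [] ≤ᵛ []
  _∷_ : ∀ {s xs} {i j : ℕ} {u v : NV xs} → i ≤ j → u ≤ᵛ v → _≤ᵛ_ {xs = s ∷ xs} (i ∷ u) (j ∷ v)

data Poly (n : ℕ) : Set where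
  var : Fin n → Poly n
  cst : ℕ → Poly n
  _⊕_ : Poly n → Poly n → Poly n
  _⊗_ : Poly n → Poly n → Poly n

evalP : ∀ {n} → Poly n → (Fin n → ℕ) → ℕ
evalP (var k) ρ = ρ k
evalP (cst c) ρ = c
evalP (p ⊕ q) ρ = evalP p ρ + evalP q ρ
evalP (p ⊗ q) ρ = evalP p ρ * evalP q ρ

IsPoly : ∀ {A : Set} {xs : List A} → (NV xs → ℕ) → Set
IsPoly {xs = xs} f = Σ (Poly (length xs)) λ p → ∀ v → f v ≡ evalP p (lookupᵛ v)

record Signature : Set₁ where
  field
    Sort : Set                              -- 1-cells
    Con  : List Sort → Sort → Set
    Fun  : List Sort → List Sort → Set

module Syntax (S : Signature) where
  open Signature S

  data Gen : List Sort → List Sort → Set where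
    τ   : (ξ ζ : Sort) → Gen (ξ ∷ ζ ∷ []) (ζ ∷ ξ ∷ [])
    δ   : (ξ : Sort) → Gen (ξ ∷ []) (ξ ∷ ξ ∷ [])
    ε   : (ξ : Sort) → Gen (ξ ∷ []) []
    con : ∀ {x ξ} → Con x ξ → Gen x (ξ ∷ [])
    fun : ∀ {x y} → Fun x y → Gen x y

  -- 2-path expressions (representatives of 2-paths)
  data Term : List Sort → List Sort → Set where
    idT  : (x : List Sort) → Term x x
    gen  : ∀ {x y} → Gen x y → Term x y
    _⋆₁_ : ∀ {x y z} → Term x y → Term y z → Term x z
    _⋆₀_ : ∀ {x y x' y'} → Term x y → Term x' y' → Term (x ++ x') (y ++ y')

  infixr 7 _⋆₁_
  infixr 8 _⋆₀_

  -- The axioms of free strict monoidal categories (deformation of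
  -- circuits).  The relation is stated heterogeneously so that the
  -- associativity of ⋆₀ can be written without transport; all its
  -- generators relate expressions with (propositionally) equal types.
  data _≈_ : ∀ {x y x' y'} → Term x y → Term x' y' → Set where
    ≈-refl  : ∀ {x y} {f : Term x y} → f ≈ f
    ≈-sym   : ∀ {x y x' y'} {f : Term x y} {g : Term x' y'} → f ≈ g → g ≈ f
    ≈-trans : ∀ {x y x' y' x'' y''} {f : Term x y} {g : Term x' y'} {h : Term x'' y''} →
              f ≈ g → g ≈ h → f ≈ h
    cong₁   : ∀ {x y z x' y' z'} {f : Term x y} {g : Term y z} {f' : Term x' y'} {g' : Term y' z'} →
              f ≈ f' → g ≈ g' → (f ⋆₁ g) ≈ (f' ⋆₁ g')
    cong₀   : ∀ {x y z w x' y' z' w'} {f : Term x y} {g : Term z w} {f' : Term x' y'} {g' : Term z' w'} →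
              f ≈ f' → g ≈ g' → (f ⋆₀ g) ≈ (f' ⋆₀ g')
    assoc₁  : ∀ {x y z w} {f : Term x y} {g : Term y z} {h : Term z w} →
              ((f ⋆₁ g) ⋆₁ h) ≈ (f ⋆₁ (g ⋆₁ h))
    unitl₁  : ∀ {x y} {f : Term x y} → (idT x ⋆₁ f) ≈ f
    unitr₁  : ∀ {x y} {f : Term x y} → (f ⋆₁ idT y) ≈ f
    assoc₀  : ∀ {x y z w u v} {f : Term x y} {g : Term z w} {h : Term u v} →
              ((f ⋆₀ g) ⋆₀ h) ≈ (f ⋆₀ (g ⋆₀ h))
    unitl₀  : ∀ {x y} {f : Term x y} → (idT [] ⋆₀ f) ≈ f
    unitr₀  : ∀ {x y} {f : Term x y} → (f ⋆₀ idT []) ≈ f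
    id⋆₀id  : ∀ {x y} → (idT x ⋆₀ idT y) ≈ idT (x ++ y)
    interchange : ∀ {x y z x' y' z'} {f : Term x y} {g : Term y z} {f' : Term x' y'} {g' : Term y' z'} →
              ((f ⋆₁ g) ⋆₀ (f' ⋆₁ g')) ≈ ((f ⋆₀ f') ⋆₁ (g ⋆₀ g'))

  data OnlyCons : ∀ {x y} → Term x y → Set where
    oc-id  : ∀ {x} → OnlyCons (idT x)
    oc-con : ∀ {x ξ} (γ : Con x ξ) → OnlyCons (gen (con γ))
    oc-⋆₁  : ∀ {x y z} {f : Term x y} {g : Term y z} → OnlyCons f → OnlyCons g → OnlyCons (f ⋆₁ g)
    oc-⋆₀  : ∀ {x y x' y'} {f : Term x y} {g : Term x' y'} → OnlyCons f → OnlyCons g → OnlyCons (f ⋆₀ g)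

  #struct : ∀ {x y} → Term x y → ℕ
  #struct (idT x) = 0
  #struct (gen (τ _ _)) = 1
  #struct (gen (δ _)) = 1
  #struct (gen (ε _)) = 1
  #struct (gen (con _)) = 0
  #struct (gen (fun _)) = 0
  #struct (f ⋆₁ g) = #struct f + #struct g
  #struct (f ⋆₀ g) = #struct f + #struct g

  τ[_,_] : (x : List Sort) (ζ : Sort) → Term (x ++ [ ζ ]) (ζ ∷ x)
  τ[ [] , ζ ] = idT [ ζ ]
  τ[ ξ ∷ x , ζ ] = (idT [ ξ ] ⋆₀ τ[ x , ζ ]) ⋆₁ (gen (τ ξ ζ) ⋆₀ idT x)

  τ⟨_,_⟩ : (ζ : Sort) (x : List Sort) → Term (ζ ∷ x) (x ++ [ ζ ])
  τ⟨ ζ , [] ⟩ = idT [ ζ ]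
  τ⟨ ζ , ξ ∷ x ⟩ = (gen (τ ζ ξ) ⋆₀ idT x) ⋆₁ (idT [ ξ ] ⋆₀ τ⟨ ζ , x ⟩)

  δ[_] : (x : List Sort) → Term x (x ++ x)
  δ[ [] ] = idT []
  δ[ ξ ∷ x ] = (gen (δ ξ) ⋆₀ δ[ x ]) ⋆₁
               (idT [ ξ ] ⋆₀ subst (Term (ξ ∷ x ++ x)) (++-assoc x [ ξ ] x) (τ⟨ ξ , x ⟩ ⋆₀ idT x))

  ε[_] : (x : List Sort) → Term x []
  ε[ [] ] = idT []
  ε[ ξ ∷ x ] = gen (ε ξ) ⋆₀ ε[ x ]

open Syntax public hiding (τ[_,_]; τ⟨_,_⟩; δ[_]; ε[_])

record Program : Set₁ where
  field
    sig : Signature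
  open Signature sig
  field
    Rule : Set                                    -- computation 3-cells
    dom mid cod : Rule → List Sort
    ctx     : (r : Rule) → Term sig (dom r) (mid r)
    ctxCons : (r : Rule) → OnlyCons sig (ctx r)
    fn      : (r : Rule) → Fun (mid r) (cod r)
    rhs     : (r : Rule) → Term sig (dom r) (cod r)

  lhs : (r : Rule) → Term sig (dom r) (cod r)
  lhs r = ctx r ⋆₁ gen (fun (fn r))

module _ (P : Program) where
  open Program P
  open Signature sig
  open Syntax sig using (τ[_,_]; τ⟨_,_⟩; δ[_]; ε[_])

  data Cell3 : ∀ {x y} → Term sig x y → Term sig x y → Set where
    τ-left  : ∀ {x ξ} (γ : Con x ξ) (ζ : Sort) →
              Cell3 ((gen (con γ) ⋆₀ idT [ ζ ]) ⋆₁ gen (τ ξ ζ))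
                    (τ[ x , ζ ] ⋆₁ (idT [ ζ ] ⋆₀ gen (con γ)))
    τ-right : ∀ {x ξ} (γ : Con x ξ) (ζ : Sort) →
              Cell3 ((idT [ ζ ] ⋆₀ gen (con γ)) ⋆₁ gen (τ ζ ξ))
                    (τ⟨ ζ , x ⟩ ⋆₁ (gen (con γ) ⋆₀ idT [ ζ ]))
    δ-cell  : ∀ {x ξ} (γ : Con x ξ) →
              Cell3 (gen (con γ) ⋆₁ gen (δ ξ)) (δ[ x ] ⋆₁ (gen (con γ) ⋆₀ gen (con γ)))
    ε-cell  : ∀ {x ξ} (γ : Con x ξ) →
              Cell3 (gen (con γ) ⋆₁ gen (ε ξ)) ε[ x ]
    comp    : (r : Rule) → Cell3 (lhs r) (rhs r)

  data _⇛_ {p q : List Sort} (f g : Term sig p q) : Set where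
    step : ∀ {x y a b} {s t : Term sig a b} → Cell3 s t →
           (h : Term sig p (x ++ (a ++ y))) (k : Term sig (x ++ (b ++ y)) q) →
           _≈_ sig f ((h ⋆₁ (idT x ⋆₀ (s ⋆₀ idT y))) ⋆₁ k) →
           _≈_ sig g ((h ⋆₁ (idT x ⋆₀ (t ⋆₀ idT y))) ⋆₁ k) →
           f ⇛ g

  Terminates : Set
  Terminates = ∀ {p q} (f : ℕ → Term sig p q) → ¬ (∀ n → f n ⇛ f (suc n))

record Interpretation (S : Signature) : Set where
  open Signature S
  field
    out       : ∀ {x y} → Gen S x y → NV x → NV y
    cost      : ∀ {x y} → Gen S x y → NV x → ℕ
    out-mono  : ∀ {x y} (g : Gen S x y) {u v : NV x} → u ≤ᵛ v → out g u ≤ᵛ out g v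
    cost-mono : ∀ {x y} (g : Gen S x y) {u v : NV x} → u ≤ᵛ v → cost g u ≤ cost g v

  ⟦_⟧* : ∀ {x y} → Term S x y → NV x → NV y
  ⟦ idT x ⟧* v = v
  ⟦ gen g ⟧* v = out g v
  ⟦ _⋆₁_ f g ⟧* v = ⟦ g ⟧* (⟦ f ⟧* v)
  ⟦ _⋆₀_ {x = x} f g ⟧* v = ⟦ f ⟧* (proj₁ (splitᵛ x v)) ++ᵛ ⟦ g ⟧* (proj₂ (splitᵛ x v))

  ⟦_⟧c : ∀ {x y} → Term S x y → NV x → ℕ
  ⟦ idT x ⟧c v = 0
  ⟦ gen g ⟧c v = cost g v
  ⟦ _⋆₁_ f g ⟧c v = ⟦ f ⟧c v + ⟦ g ⟧c (⟦ f ⟧* v)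
  ⟦ _⋆₀_ {x = x} f g ⟧c v = ⟦ f ⟧c (proj₁ (splitᵛ x v)) + ⟦ g ⟧c (proj₂ (splitᵛ x v))

record IsSimple {S : Signature} (I : Interpretation S) : Set where
  open Signature S
  open Interpretation I
  field
    sum-poly  : ∀ {x y} (g : Gen S x y) → IsPoly (λ v → sumᵛ (out g v))
    cost-poly : ∀ {x y} (g : Gen S x y) → IsPoly (cost g)
    a-con     : ∀ {x ξ} → Con x ξ → ℕ
    con-out   : ∀ {x ξ} (γ : Con x ξ) (v : NV x) → out (con γ) v ≡ (sumᵛ v + a-con γ) ∷ []
    con-pos   : ∀ {x ξ} (γ : Con x ξ) → 0 < a-con γ
    con-cost  : ∀ {x ξ} (γ : Con x ξ) (v : NV x) → cost (con γ) v ≡ 0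
    a         : ℕ
    a-pos     : 0 < a
    a-bound   : ∀ {x ξ} (γ : Con x ξ) → a-con γ ≤ a
    τ-out     : ∀ ξ ζ (i j : ℕ) → out (τ ξ ζ) (i ∷ j ∷ []) ≡ j ∷ i ∷ []
    δ-out     : ∀ ξ (i : ℕ) → out (δ ξ) (i ∷ []) ≡ i ∷ i ∷ []
    τ-cost    : ∀ ξ ζ (v : NV (ξ ∷ ζ ∷ [])) → cost (τ ξ ζ) v ≡ 0
    δ-cost    : ∀ ξ (v : NV (ξ ∷ [])) → cost (δ ξ) v ≡ 0
    ε-cost    : ∀ ξ (v : NV (ξ ∷ [])) → cost (ε ξ) v ≡ 0
    fun-out   : ∀ {x y} (φ : Fun x y) (v : NV x) → sumᵛ v ≤ sumᵛ (out (fun φ) v)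

Compatible : (P : Program) → Interpretation (Program.sig P) → Set
Compatible P I = ∀ (r : Rule) (v : NV (dom r)) →
                 (⟦ rhs r ⟧* v ≤ᵛ ⟦ lhs r ⟧* v) × (⟦ rhs r ⟧c v < ⟦ lhs r ⟧c v)
  where open Program P
        open Interpretation I

record SimpleProgram (P : Program) : Set where
  open Program P
  field
    K            : ℕ
    struct-bound : ∀ (r : Rule) → #struct sig (rhs r) ≤ K
    interp       : Interpretation sig
    interp-simple : IsSimple interp
    interp-compat : Compatible P interp

-- Termination is witnessed by a lexicographic measure on 2-paths: the pair of costs, at the all-zero
-- input, under the given simple interpretation and under an auxiliary wire-weight interpretation.
-- Both interpretations are invariant under the deformation axioms and monotone, so the measure is
-- well defined on 2-paths and a 3-cell that decreases it does so in every context.  A computation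
-- 3-cell strictly decreases the first cost, by compatibility.  A structure 3-cell leaves outputs
-- unchanged and its target is built from structure 2-cells and constructors only, which cost nothing
-- in a simple interpretation, so the first cost does not grow.  In the wire-weight interpretation a
-- wire carrying i weighs i + 1, τ costs the product of the weights of its two wires, δ the square and
-- ε the weight of its wire, and a constructor outputs the total weight of its inputs; pushing a
-- constructor through τ, δ or ε then strictly lowers the second cost.

module Submission where

open import Defs
open import Data.List using (List; []; _∷_; _++_; [_]; length)
open import Data.List.Properties using (++-assoc; ++-identityʳ; length-++; ∷-injective)
open import Data.Nat using (ℕ; suc; _+_; _*_; _≤_; _<_; z≤n; s≤s; z<s)
open import Data.Nat.Properties
open import Data.Nat.Induction using (<-wellFounded)
open import Data.Nat.Tactic.RingSolver using (solve-∀)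
open import Algebra.Properties.CommutativeSemigroup +-commutativeSemigroup
  using () renaming (interchange to +-interchange)
open import Data.Product using (_×_; _,_; proj₁; proj₂; map; map₁; zip′)
open import Data.Product.Relation.Binary.Lex.Strict using (×-Lex; ×-wellFounded)
open import Data.Sum using (_⊎_; inj₁; inj₂)
open import Function using (_∘_)
open import Induction.WellFounded using (Acc; acc; WellFounded)
open import Relation.Binary.PropositionalEquality hiding ([_])
open import Relation.Nullary using (¬_)

module _ {A : Set} where

  toList : {xs : List A} → NV xs → List ℕ
  toList [] = []
  toList (i ∷ v) = i ∷ toList v

  -- ≈ relates 2-paths over different (though propositionally equal) 1-paths, so vectors are
  -- compared through their lists of entries.
  infix 4 _≋_

  _≋_ : {xs ys : List A} → NV xs → NV ys → Set
  u ≋ v = toList u ≡ toList v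

  ≋⇒≡ : {xs : List A} {u v : NV xs} → u ≋ v → u ≡ v
  ≋⇒≡ {u = []} {[]} _ = refl
  ≋⇒≡ {u = i ∷ u} {j ∷ v} e with ∷-injective e
  ... | refl , e′ = cong (i ∷_) (≋⇒≡ e′)

  toList-++ᵛ : {xs ys : List A} (u : NV xs) (w : NV ys) → toList (u ++ᵛ w) ≡ toList u ++ toList w
  toList-++ᵛ [] w = refl
  toList-++ᵛ (i ∷ u) w = cong (i ∷_) (toList-++ᵛ u w)

  ++ᵛ-resp-≋ : {xs ys xs′ ys′ : List A} {u : NV xs} {w : NV ys} {u′ : NV xs′} {w′ : NV ys′} →
               u ≋ u′ → w ≋ w′ → (u ++ᵛ w) ≋ (u′ ++ᵛ w′)
  ++ᵛ-resp-≋ {u = u} {w} {u′} {w′} e e′ = begin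
    toList (u ++ᵛ w)          ≡⟨ toList-++ᵛ u w ⟩
    toList u ++ toList w      ≡⟨ cong₂ _++_ e e′ ⟩
    toList u′ ++ toList w′    ≡⟨ toList-++ᵛ u′ w′ ⟨
    toList (u′ ++ᵛ w′)        ∎
    where open ≡-Reasoning

  ++ᵛ-assoc-≋ : {xs ys zs : List A} (u : NV xs) (v : NV ys) (w : NV zs) →
                ((u ++ᵛ v) ++ᵛ w) ≋ (u ++ᵛ (v ++ᵛ w))
  ++ᵛ-assoc-≋ [] v w = refl
  ++ᵛ-assoc-≋ (i ∷ u) v w = cong (i ∷_) (++ᵛ-assoc-≋ u v w)

  ++ᵛ-identityʳ-≋ : {xs : List A} (u : NV xs) → (u ++ᵛ []) ≋ u
  ++ᵛ-identityʳ-≋ [] = refl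
  ++ᵛ-identityʳ-≋ (i ∷ u) = cong (i ∷_) (++ᵛ-identityʳ-≋ u)

  reindex : {xs ys : List A} → length xs ≡ length ys → NV xs → NV ys
  reindex {ys = []} _ [] = []
  reindex {ys = _ ∷ _} () []
  reindex {ys = []} () (_ ∷ _)
  reindex {ys = _ ∷ ys} e (i ∷ v) = i ∷ reindex {ys = ys} (suc-injective e) v

  reindex-≋ : {xs ys : List A} (e : length xs ≡ length ys) (v : NV xs) → reindex {ys = ys} e v ≋ v
  reindex-≋ {ys = []} _ [] = refl
  reindex-≋ {ys = _ ∷ ys} e (i ∷ v) = cong (i ∷_) (reindex-≋ {ys = ys} (suc-injective e) v)

  subst-≋ : {xs ys : List A} (e : xs ≡ ys) (v : NV xs) → subst NV e v ≋ v
  subst-≋ refl v = refl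

  splitᵛ-++ᵛ : (xs : List A) {ys : List A} (u : NV xs) (w : NV ys) → splitᵛ xs (u ++ᵛ w) ≡ (u , w)
  splitᵛ-++ᵛ [] [] w = refl
  splitᵛ-++ᵛ (_ ∷ xs) (i ∷ u) w rewrite splitᵛ-++ᵛ xs u w = refl

  ++ᵛ-splitᵛ : (xs : List A) {ys : List A} (v : NV (xs ++ ys)) →
               proj₁ (splitᵛ xs v) ++ᵛ proj₂ (splitᵛ xs v) ≡ v
  ++ᵛ-splitᵛ [] v = refl
  ++ᵛ-splitᵛ (_ ∷ xs) (i ∷ v) = cong (i ∷_) (++ᵛ-splitᵛ xs v)

  data Split (xs : List A) {ys : List A} : NV (xs ++ ys) → Set where
    split : (u : NV xs) (w : NV ys) → Split xs (u ++ᵛ w)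

  splitView : (xs : List A) {ys : List A} (v : NV (xs ++ ys)) → Split xs v
  splitView xs v = subst (Split xs) (++ᵛ-splitᵛ xs v) (split (proj₁ (splitᵛ xs v)) (proj₂ (splitᵛ xs v)))

  splitᵛ-resp-≋ : (xs xs′ : List A) {ys ys′ : List A} {v : NV (xs ++ ys)} {v′ : NV (xs′ ++ ys′)} →
                  length xs ≡ length xs′ → v ≋ v′ →
                  (proj₁ (splitᵛ xs v) ≋ proj₁ (splitᵛ xs′ v′)) ×
                  (proj₂ (splitᵛ xs v) ≋ proj₂ (splitᵛ xs′ v′))
  splitᵛ-resp-≋ [] [] _ e = refl , e
  splitᵛ-resp-≋ (_ ∷ xs) (_ ∷ xs′) {v = i ∷ v} {j ∷ v′} len e =
    let head , tail = ∷-injective e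
        prefix , suffix = splitᵛ-resp-≋ xs xs′ (suc-injective len) tail
    in cong₂ _∷_ head prefix , suffix

  ≤ᵛ-refl : {xs : List A} (v : NV xs) → v ≤ᵛ v
  ≤ᵛ-refl [] = []
  ≤ᵛ-refl (i ∷ v) = ≤-refl ∷ ≤ᵛ-refl v

  ≤ᵛ-reflexive : {xs : List A} {u v : NV xs} → u ≡ v → u ≤ᵛ v
  ≤ᵛ-reflexive {u = u} refl = ≤ᵛ-refl u

  ++ᵛ-mono-≤ᵛ : {xs ys : List A} {u u′ : NV xs} {w w′ : NV ys} →
                u ≤ᵛ u′ → w ≤ᵛ w′ → (u ++ᵛ w) ≤ᵛ (u′ ++ᵛ w′)
  ++ᵛ-mono-≤ᵛ [] q = q
  ++ᵛ-mono-≤ᵛ (p ∷ ps) q = p ∷ ++ᵛ-mono-≤ᵛ ps q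

  splitᵛ-mono-≤ᵛ : (xs : List A) {ys : List A} {u v : NV (xs ++ ys)} → u ≤ᵛ v →
                   (proj₁ (splitᵛ xs u) ≤ᵛ proj₁ (splitᵛ xs v)) ×
                   (proj₂ (splitᵛ xs u) ≤ᵛ proj₂ (splitᵛ xs v))
  splitᵛ-mono-≤ᵛ [] p = [] , p
  splitᵛ-mono-≤ᵛ (_ ∷ xs) (p ∷ ps) = map₁ (p ∷_) (splitᵛ-mono-≤ᵛ xs ps)

  zerosᵛ : (xs : List A) → NV xs
  zerosᵛ [] = []
  zerosᵛ (_ ∷ xs) = 0 ∷ zerosᵛ xs

module _ {S : Signature} where
  open Signature S

  whisker : ∀ {a b} (x y : List Sort) → Term S a b → Term S (x ++ (a ++ y)) (x ++ (b ++ y))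
  whisker x y s = idT x ⋆₀ (s ⋆₀ idT y)

  inContext : ∀ {p q a b} (x y : List Sort) → Term S p (x ++ (a ++ y)) → Term S (x ++ (b ++ y)) q →
              Term S a b → Term S p q
  inContext x y h k s = (h ⋆₁ whisker x y s) ⋆₁ k

module Semantics {S : Signature} (I : Interpretation S) where
  open Signature S
  open Interpretation I

  ≈-length-dom : ∀ {x y x′ y′} {f : Term S x y} {g : Term S x′ y′} → _≈_ S f g → length x ≡ length x′
  ≈-length-dom ≈-refl = refl
  ≈-length-dom (≈-sym p) = sym (≈-length-dom p)
  ≈-length-dom (≈-trans p q) = trans (≈-length-dom p) (≈-length-dom q)
  ≈-length-dom (cong₁ p q) = ≈-length-dom p
  ≈-length-dom (cong₀ {x = x} {x' = x′} p q) =
    trans (length-++ x) (trans (cong₂ _+_ (≈-length-dom p) (≈-length-dom q)) (sym (length-++ x′)))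
  ≈-length-dom assoc₁ = refl
  ≈-length-dom unitl₁ = refl
  ≈-length-dom unitr₁ = refl
  ≈-length-dom (assoc₀ {x = x} {z = z} {u = u}) = cong length (++-assoc x z u)
  ≈-length-dom unitl₀ = refl
  ≈-length-dom (unitr₀ {x = x}) = cong length (++-identityʳ x)
  ≈-length-dom id⋆₀id = refl
  ≈-length-dom interchange = refl

  ⟦⟧-resp-≈ : ∀ {x y x′ y′} {f : Term S x y} {g : Term S x′ y′} → _≈_ S f g →
              ∀ {v : NV x} {v′ : NV x′} → v ≋ v′ →
              (⟦ f ⟧* v ≋ ⟦ g ⟧* v′) × (⟦ f ⟧c v ≡ ⟦ g ⟧c v′)
  ⟦⟧-resp-≈ ≈-refl e with ≋⇒≡ e
  ... | refl = refl , refl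
  ⟦⟧-resp-≈ (≈-sym p) e = map sym sym (⟦⟧-resp-≈ p (sym e))
  ⟦⟧-resp-≈ (≈-trans {x' = xₘ} p q) {v} e =
    zip′ trans trans (⟦⟧-resp-≈ p (sym (reindex-≋ {ys = xₘ} (≈-length-dom p) v)))
                     (⟦⟧-resp-≈ q (trans (reindex-≋ {ys = xₘ} (≈-length-dom p) v) e))
  ⟦⟧-resp-≈ (cong₁ p q) e =
    let out₁ , cost₁ = ⟦⟧-resp-≈ p e
        out₂ , cost₂ = ⟦⟧-resp-≈ q out₁
    in out₂ , cong₂ _+_ cost₁ cost₂
  ⟦⟧-resp-≈ (cong₀ {x = x} {x' = x′} p q) e =
    let prefix , suffix = splitᵛ-resp-≋ x x′ (≈-length-dom p) e
    in zip′ ++ᵛ-resp-≋ (cong₂ _+_) (⟦⟧-resp-≈ p prefix) (⟦⟧-resp-≈ q suffix)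
  ⟦⟧-resp-≈ (assoc₁ {f = f} {g}) {v} e with ≋⇒≡ e
  ... | refl = refl , +-assoc (⟦ f ⟧c v) _ _
  ⟦⟧-resp-≈ unitl₁ e with ≋⇒≡ e
  ... | refl = refl , refl
  ⟦⟧-resp-≈ unitr₁ e with ≋⇒≡ e
  ... | refl = refl , +-identityʳ _
  ⟦⟧-resp-≈ (assoc₀ {x = x} {z = z} {f = f} {g} {h}) {v} {v′} e with splitView x v′
  ... | split a bc with splitView z bc
  ... | split b c with ≋⇒≡ (trans e (sym (++ᵛ-assoc-≋ a b c)))
  ... | refl rewrite splitᵛ-++ᵛ (x ++ z) (a ++ᵛ b) c | splitᵛ-++ᵛ x a b
                   | splitᵛ-++ᵛ x a (b ++ᵛ c) | splitᵛ-++ᵛ z b c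
      = ++ᵛ-assoc-≋ (⟦ f ⟧* a) (⟦ g ⟧* b) (⟦ h ⟧* c) , +-assoc (⟦ f ⟧c a) _ _
  ⟦⟧-resp-≈ unitl₀ e with ≋⇒≡ e
  ... | refl = refl , refl
  ⟦⟧-resp-≈ (unitr₀ {x = x} {f = f}) {v} e with splitView x v
  ... | split u [] rewrite splitᵛ-++ᵛ x u [] with ≋⇒≡ (trans (sym (++ᵛ-identityʳ-≋ u)) e)
  ... | refl = ++ᵛ-identityʳ-≋ (⟦ f ⟧* u) , +-identityʳ _
  ⟦⟧-resp-≈ (id⋆₀id {x = x}) {v} e = trans (cong toList (++ᵛ-splitᵛ x v)) e , refl
  ⟦⟧-resp-≈ (interchange {x = x} {y = y} {f = f} {g} {f′} {g′}) {v} e with ≋⇒≡ e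
  ... | refl with splitView x v
  ... | split u w rewrite splitᵛ-++ᵛ x u w | splitᵛ-++ᵛ y (⟦ f ⟧* u) (⟦ f′ ⟧* w) =
    refl , +-interchange (⟦ f ⟧c u) (⟦ g ⟧c (⟦ f ⟧* u)) (⟦ f′ ⟧c w) (⟦ g′ ⟧c (⟦ f′ ⟧* w))

  ⟦⟧*-mono : ∀ {x y} (f : Term S x y) {u v : NV x} → u ≤ᵛ v → ⟦ f ⟧* u ≤ᵛ ⟦ f ⟧* v
  ⟦⟧*-mono (idT x) p = p
  ⟦⟧*-mono (gen g) p = out-mono g p
  ⟦⟧*-mono (f ⋆₁ g) p = ⟦⟧*-mono g (⟦⟧*-mono f p)
  ⟦⟧*-mono (_⋆₀_ {x = x} f g) p =
    let prefix , suffix = splitᵛ-mono-≤ᵛ x p in ++ᵛ-mono-≤ᵛ (⟦⟧*-mono f prefix) (⟦⟧*-mono g suffix)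

  ⟦⟧c-mono : ∀ {x y} (f : Term S x y) {u v : NV x} → u ≤ᵛ v → ⟦ f ⟧c u ≤ ⟦ f ⟧c v
  ⟦⟧c-mono (idT x) p = ≤-refl
  ⟦⟧c-mono (gen g) p = cost-mono g p
  ⟦⟧c-mono (f ⋆₁ g) p = +-mono-≤ (⟦⟧c-mono f p) (⟦⟧c-mono g (⟦⟧*-mono f p))
  ⟦⟧c-mono (_⋆₀_ {x = x} f g) p =
    let prefix , suffix = splitᵛ-mono-≤ᵛ x p in +-mono-≤ (⟦⟧c-mono f prefix) (⟦⟧c-mono g suffix)

  infix 4 _≼_ _≺_

  record _≼_ {a b} (t s : Term S a b) : Set where
    field
      out-≤  : ∀ w → ⟦ t ⟧* w ≤ᵛ ⟦ s ⟧* w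
      cost-≤ : ∀ w → ⟦ t ⟧c w ≤ ⟦ s ⟧c w

  record _≺_ {a b} (t s : Term S a b) : Set where
    field
      out-≤  : ∀ w → ⟦ t ⟧* w ≤ᵛ ⟦ s ⟧* w
      cost-< : ∀ w → ⟦ t ⟧c w < ⟦ s ⟧c w

  open _≼_ public
  open _≺_ public

  whisker-mono-≤ᵛ : ∀ {a b} (x y : List Sort) {s t : Term S a b} → (∀ w → ⟦ t ⟧* w ≤ᵛ ⟦ s ⟧* w) →
                    ∀ w → ⟦ whisker x y t ⟧* w ≤ᵛ ⟦ whisker x y s ⟧* w
  whisker-mono-≤ᵛ {a} x y le w =
    let v = proj₂ (splitᵛ x w)
    in ++ᵛ-mono-≤ᵛ (≤ᵛ-refl (proj₁ (splitᵛ x w)))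
                  (++ᵛ-mono-≤ᵛ (le (proj₁ (splitᵛ a v))) (≤ᵛ-refl (proj₂ (splitᵛ a v))))

  whisker-mono-≼ : ∀ {a b} (x y : List Sort) {s t : Term S a b} → t ≼ s → whisker x y t ≼ whisker x y s
  whisker-mono-≼ x y {s} {t} t≼s .out-≤ = whisker-mono-≤ᵛ x y {s} {t} (out-≤ t≼s)
  whisker-mono-≼ {a} x y t≼s .cost-≤ w =
    +-monoʳ-≤ 0 (+-monoˡ-≤ 0 (cost-≤ t≼s (proj₁ (splitᵛ a (proj₂ (splitᵛ x w))))))

  whisker-mono-≺ : ∀ {a b} (x y : List Sort) {s t : Term S a b} → t ≺ s → whisker x y t ≺ whisker x y s
  whisker-mono-≺ x y {s} {t} t≺s .out-≤ = whisker-mono-≤ᵛ x y {s} {t} (out-≤ t≺s)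
  whisker-mono-≺ {a} x y t≺s .cost-< w =
    +-monoʳ-< 0 (+-monoˡ-< 0 (cost-< t≺s (proj₁ (splitᵛ a (proj₂ (splitᵛ x w))))))

  ⋆₁-monoʳ-≼ : ∀ {p a b} (h : Term S p a) {s t : Term S a b} → t ≼ s → (h ⋆₁ t) ≼ (h ⋆₁ s)
  ⋆₁-monoʳ-≼ h t≼s .out-≤ w = out-≤ t≼s (⟦ h ⟧* w)
  ⋆₁-monoʳ-≼ h t≼s .cost-≤ w = +-monoʳ-≤ (⟦ h ⟧c w) (cost-≤ t≼s (⟦ h ⟧* w))

  ⋆₁-monoʳ-≺ : ∀ {p a b} (h : Term S p a) {s t : Term S a b} → t ≺ s → (h ⋆₁ t) ≺ (h ⋆₁ s)
  ⋆₁-monoʳ-≺ h t≺s .out-≤ w = out-≤ t≺s (⟦ h ⟧* w)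
  ⋆₁-monoʳ-≺ h t≺s .cost-< w = +-monoʳ-< (⟦ h ⟧c w) (cost-< t≺s (⟦ h ⟧* w))

  ⋆₁-monoˡ-≼ : ∀ {a b q} (k : Term S b q) {s t : Term S a b} → t ≼ s → (t ⋆₁ k) ≼ (s ⋆₁ k)
  ⋆₁-monoˡ-≼ k t≼s .out-≤ w = ⟦⟧*-mono k (out-≤ t≼s w)
  ⋆₁-monoˡ-≼ k t≼s .cost-≤ w = +-mono-≤ (cost-≤ t≼s w) (⟦⟧c-mono k (out-≤ t≼s w))

  ⋆₁-monoˡ-≺ : ∀ {a b q} (k : Term S b q) {s t : Term S a b} → t ≺ s → (t ⋆₁ k) ≺ (s ⋆₁ k)
  ⋆₁-monoˡ-≺ k t≺s .out-≤ w = ⟦⟧*-mono k (out-≤ t≺s w)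
  ⋆₁-monoˡ-≺ k t≺s .cost-< w = +-mono-<-≤ (cost-< t≺s w) (⟦⟧c-mono k (out-≤ t≺s w))

  inContext-mono-≼ : ∀ {p q a b} (x y : List Sort) (h : Term S p (x ++ (a ++ y))) (k : Term S (x ++ (b ++ y)) q)
                     {s t : Term S a b} → t ≼ s → inContext x y h k t ≼ inContext x y h k s
  inContext-mono-≼ x y h k = ⋆₁-monoˡ-≼ k ∘ ⋆₁-monoʳ-≼ h ∘ whisker-mono-≼ x y

  inContext-mono-≺ : ∀ {p q a b} (x y : List Sort) (h : Term S p (x ++ (a ++ y))) (k : Term S (x ++ (b ++ y)) q)
                     {s t : Term S a b} → t ≺ s → inContext x y h k t ≺ inContext x y h k s
  inContext-mono-≺ x y h k = ⋆₁-monoˡ-≺ k ∘ ⋆₁-monoʳ-≺ h ∘ whisker-mono-≺ x y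

  ⟦subst⟧* : ∀ {x y y′} (e : y ≡ y′) (t : Term S x y) v →
             ⟦ subst (Term S x) e t ⟧* v ≡ subst NV e (⟦ t ⟧* v)
  ⟦subst⟧* refl t v = refl

  ⟦subst⟧c : ∀ {x y y′} (e : y ≡ y′) (t : Term S x y) v → ⟦ subst (Term S x) e t ⟧c v ≡ ⟦ t ⟧c v
  ⟦subst⟧c refl t v = refl

  record CostFree {x y} (t : Term S x y) : Set where
    field cost≡0 : ∀ v → ⟦ t ⟧c v ≡ 0

  open CostFree public

  gen-costFree : ∀ {x y} {g : Gen S x y} → (∀ v → cost g v ≡ 0) → CostFree (gen g)
  gen-costFree g₀ .cost≡0 = g₀

  idT-costFree : ∀ x → CostFree (idT x)
  idT-costFree x .cost≡0 v = refl

  ⋆₁-costFree : ∀ {x y z} {f : Term S x y} {g : Term S y z} → CostFree f → CostFree g → CostFree (f ⋆₁ g)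
  ⋆₁-costFree {f = f} f₀ g₀ .cost≡0 v rewrite cost≡0 f₀ v | cost≡0 g₀ (⟦ f ⟧* v) = refl

  ⋆₀-costFree : ∀ {x y x′ y′} {f : Term S x y} {g : Term S x′ y′} →
                CostFree f → CostFree g → CostFree (f ⋆₀ g)
  ⋆₀-costFree {x = x} f₀ g₀ .cost≡0 v
    rewrite cost≡0 f₀ (proj₁ (splitᵛ x v)) | cost≡0 g₀ (proj₂ (splitᵛ x v)) = refl

  subst-costFree : ∀ {x y y′} (e : y ≡ y′) {t : Term S x y} → CostFree t → CostFree (subst (Term S x) e t)
  subst-costFree refl t₀ = t₀

  costFree-≼ : ∀ {a b} {s t : Term S a b} → (∀ w → ⟦ t ⟧* w ≡ ⟦ s ⟧* w) → CostFree t → t ≼ s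
  costFree-≼ same-out t₀ .out-≤ w = ≤ᵛ-reflexive (same-out w)
  costFree-≼ same-out t₀ .cost-≤ w rewrite cost≡0 t₀ w = z≤n

module StructureCells (S : Signature) where
  open Signature S
  open Syntax S using (τ[_,_]; τ⟨_,_⟩; δ[_]; ε[_])

  τˡ-source τˡ-target : ∀ {x ξ} → Con x ξ → (ζ : Sort) → Term S (x ++ [ ζ ]) (ζ ∷ ξ ∷ [])
  τˡ-source {ξ = ξ} γ ζ = (gen (con γ) ⋆₀ idT [ ζ ]) ⋆₁ gen (τ ξ ζ)
  τˡ-target {x} γ ζ = τ[ x , ζ ] ⋆₁ (idT [ ζ ] ⋆₀ gen (con γ))

  τʳ-source τʳ-target : ∀ {x ξ} → Con x ξ → (ζ : Sort) → Term S (ζ ∷ x) (ξ ∷ ζ ∷ [])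
  τʳ-source {ξ = ξ} γ ζ = (idT [ ζ ] ⋆₀ gen (con γ)) ⋆₁ gen (τ ζ ξ)
  τʳ-target {x} γ ζ = τ⟨ ζ , x ⟩ ⋆₁ (gen (con γ) ⋆₀ idT [ ζ ])

  δ-source δ-target : ∀ {x ξ} → Con x ξ → Term S x (ξ ∷ ξ ∷ [])
  δ-source {ξ = ξ} γ = gen (con γ) ⋆₁ gen (δ ξ)
  δ-target {x} γ = δ[ x ] ⋆₁ (gen (con γ) ⋆₀ gen (con γ))

  ε-source ε-target : ∀ {x ξ} → Con x ξ → Term S x []
  ε-source {ξ = ξ} γ = gen (con γ) ⋆₁ gen (ε ξ)
  ε-target {x} γ = ε[ x ]

module SwapDuplicate {S : Signature} (I : Interpretation S)
  (τ-swap : ∀ ξ ζ (i j : ℕ) → Interpretation.out I (τ ξ ζ) (i ∷ j ∷ []) ≡ j ∷ i ∷ [])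
  (δ-dup  : ∀ ξ (i : ℕ) → Interpretation.out I (δ ξ) (i ∷ []) ≡ i ∷ i ∷ []) where
  open Signature S
  open Interpretation I
  open Semantics I
  open Syntax S using (τ[_,_]; τ⟨_,_⟩; δ[_])
  open StructureCells S

  ⟦τ[]⟧* : ∀ x ζ (u : NV x) (j : ℕ) → ⟦ τ[ x , ζ ] ⟧* (u ++ᵛ (j ∷ [])) ≡ j ∷ u
  ⟦τ[]⟧* [] ζ [] j = refl
  ⟦τ[]⟧* (ξ ∷ x) ζ (i ∷ u) j rewrite ⟦τ[]⟧* x ζ u j | τ-swap ξ ζ i j = refl

  ⟦τ⟨⟩⟧* : ∀ ζ x (j : ℕ) (u : NV x) → ⟦ τ⟨ ζ , x ⟩ ⟧* (j ∷ u) ≡ u ++ᵛ (j ∷ [])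
  ⟦τ⟨⟩⟧* ζ [] j [] = refl
  ⟦τ⟨⟩⟧* ζ (ξ ∷ x) j (i ∷ u) rewrite τ-swap ζ ξ j i | ⟦τ⟨⟩⟧* ζ x j u = refl

  ⟦δ[]⟧* : ∀ x (u : NV x) → ⟦ δ[ x ] ⟧* u ≡ u ++ᵛ u
  ⟦δ[]⟧* [] [] = refl
  ⟦δ[]⟧* (ξ ∷ x) (i ∷ u) rewrite ⟦δ[]⟧* x u | δ-dup ξ i
    | ⟦subst⟧* (++-assoc x [ ξ ] x) (τ⟨ ξ , x ⟩ ⋆₀ idT x) (i ∷ (u ++ᵛ u))
    | splitᵛ-++ᵛ x u u | ⟦τ⟨⟩⟧* ξ x i u
    = cong (i ∷_) (≋⇒≡ (trans (subst-≋ (++-assoc x [ ξ ] x) _) (++ᵛ-assoc-≋ u (i ∷ []) u)))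

  τˡ-same-out : ∀ {x ξ} (γ : Con x ξ) (ζ : Sort) v → ⟦ τˡ-target γ ζ ⟧* v ≡ ⟦ τˡ-source γ ζ ⟧* v
  τˡ-same-out {x} {ξ} γ ζ v with splitView x v
  ... | split u (j ∷ []) rewrite splitᵛ-++ᵛ x {[ ζ ]} u (j ∷ []) | ⟦τ[]⟧* x ζ u j with out (con γ) u
  ... | c ∷ [] = sym (τ-swap ξ ζ c j)

  τʳ-same-out : ∀ {x ξ} (γ : Con x ξ) (ζ : Sort) v → ⟦ τʳ-target γ ζ ⟧* v ≡ ⟦ τʳ-source γ ζ ⟧* v
  τʳ-same-out {x} {ξ} γ ζ (j ∷ u) rewrite ⟦τ⟨⟩⟧* ζ x j u | splitᵛ-++ᵛ x {[ ζ ]} u (j ∷ [])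
    with out (con γ) u
  ... | c ∷ [] = sym (τ-swap ζ ξ j c)

  δ-same-out : ∀ {x ξ} (γ : Con x ξ) v → ⟦ δ-target γ ⟧* v ≡ ⟦ δ-source γ ⟧* v
  δ-same-out {x} {ξ} γ v rewrite ⟦δ[]⟧* x v | splitᵛ-++ᵛ x v v with out (con γ) v
  ... | c ∷ [] = sym (δ-dup ξ c)

  ε-same-out : ∀ {x ξ} (γ : Con x ξ) v → ⟦ ε-target γ ⟧* v ≡ ⟦ ε-source γ ⟧* v
  ε-same-out γ v with ⟦ ε-target γ ⟧* v | ⟦ ε-source γ ⟧* v
  ... | [] | [] = refl

module SimpleInterpretation {S : Signature} {I : Interpretation S} (simple : IsSimple I) where
  open Signature S
  open IsSimple simple using (τ-out; δ-out; τ-cost; δ-cost; ε-cost; con-cost)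
  open Semantics I
  open SwapDuplicate I τ-out δ-out
  open StructureCells S
  open Syntax S using (τ[_,_]; τ⟨_,_⟩; δ[_]; ε[_])

  con-costFree : ∀ {x ξ} (γ : Con x ξ) → CostFree (gen (con γ))
  con-costFree γ = gen-costFree (con-cost γ)

  τ[]-costFree : ∀ x ζ → CostFree τ[ x , ζ ]
  τ[]-costFree [] ζ = idT-costFree _
  τ[]-costFree (ξ ∷ x) ζ =
    ⋆₁-costFree (⋆₀-costFree (idT-costFree _) (τ[]-costFree x ζ))
                (⋆₀-costFree (gen-costFree (τ-cost ξ ζ)) (idT-costFree x))

  τ⟨⟩-costFree : ∀ ζ x → CostFree τ⟨ ζ , x ⟩
  τ⟨⟩-costFree ζ [] = idT-costFree _
  τ⟨⟩-costFree ζ (ξ ∷ x) =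
    ⋆₁-costFree (⋆₀-costFree (gen-costFree (τ-cost ζ ξ)) (idT-costFree x))
                (⋆₀-costFree (idT-costFree _) (τ⟨⟩-costFree ζ x))

  δ[]-costFree : ∀ x → CostFree δ[ x ]
  δ[]-costFree [] = idT-costFree _
  δ[]-costFree (ξ ∷ x) =
    ⋆₁-costFree (⋆₀-costFree (gen-costFree (δ-cost ξ)) (δ[]-costFree x))
                (⋆₀-costFree (idT-costFree _)
                             (subst-costFree (++-assoc x [ ξ ] x)
                                             (⋆₀-costFree (τ⟨⟩-costFree ξ x) (idT-costFree x))))

  ε[]-costFree : ∀ x → CostFree ε[ x ]
  ε[]-costFree [] = idT-costFree _
  ε[]-costFree (ξ ∷ x) = ⋆₀-costFree (gen-costFree (ε-cost ξ)) (ε[]-costFree x)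

  τˡ-≼ : ∀ {x ξ} (γ : Con x ξ) (ζ : Sort) → τˡ-target γ ζ ≼ τˡ-source γ ζ
  τˡ-≼ {x} γ ζ =
    costFree-≼ (τˡ-same-out γ ζ)
               (⋆₁-costFree (τ[]-costFree x ζ) (⋆₀-costFree (idT-costFree _) (con-costFree γ)))

  τʳ-≼ : ∀ {x ξ} (γ : Con x ξ) (ζ : Sort) → τʳ-target γ ζ ≼ τʳ-source γ ζ
  τʳ-≼ {x} γ ζ =
    costFree-≼ (τʳ-same-out γ ζ)
               (⋆₁-costFree (τ⟨⟩-costFree ζ x) (⋆₀-costFree (con-costFree γ) (idT-costFree _)))

  δ-≼ : ∀ {x ξ} (γ : Con x ξ) → δ-target γ ≼ δ-source γ
  δ-≼ {x} γ =
    costFree-≼ (δ-same-out γ) (⋆₁-costFree (δ[]-costFree x) (⋆₀-costFree (con-costFree γ) (con-costFree γ)))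

  ε-≼ : ∀ {x ξ} (γ : Con x ξ) → ε-target γ ≼ ε-source γ
  ε-≼ {x} γ = costFree-≼ (ε-same-out γ) (ε[]-costFree x)

module WireWeight (S : Signature) where
  open Signature S
  open Syntax S using (τ[_,_]; τ⟨_,_⟩; δ[_]; ε[_])
  open StructureCells S

  weight : ∀ {xs : List Sort} → NV xs → ℕ
  weight [] = 0
  weight (i ∷ v) = suc i + weight v

  weight-mono : ∀ {xs : List Sort} {u v : NV xs} → u ≤ᵛ v → weight u ≤ weight v
  weight-mono [] = z≤n
  weight-mono (p ∷ ps) = +-mono-≤ (s≤s p) (weight-mono ps)

  -- The outputs of functions are irrelevant: computation 3-cells are handled by the first component
  -- of the measure.
  out : ∀ {x y} → Gen S x y → NV x → NV y
  out (τ ξ ζ) (i ∷ j ∷ []) = j ∷ i ∷ []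
  out (δ ξ) (i ∷ []) = i ∷ i ∷ []
  out (ε ξ) _ = []
  out (con γ) v = suc (weight v) ∷ []
  out (fun {y = y} φ) v = zerosᵛ y

  cost : ∀ {x y} → Gen S x y → NV x → ℕ
  cost (τ ξ ζ) (i ∷ j ∷ []) = suc i * suc j
  cost (δ ξ) (i ∷ []) = suc i * suc i
  cost (ε ξ) (i ∷ []) = suc i
  cost (con γ) v = 0
  cost (fun φ) v = 0

  out-mono : ∀ {x y} (g : Gen S x y) {u v : NV x} → u ≤ᵛ v → out g u ≤ᵛ out g v
  out-mono (τ ξ ζ) (p ∷ q ∷ []) = q ∷ p ∷ []
  out-mono (δ ξ) (p ∷ []) = p ∷ p ∷ []
  out-mono (ε ξ) _ = []
  out-mono (con γ) p = s≤s (weight-mono p) ∷ []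
  out-mono (fun {y = y} φ) p = ≤ᵛ-refl (zerosᵛ y)

  cost-mono : ∀ {x y} (g : Gen S x y) {u v : NV x} → u ≤ᵛ v → cost g u ≤ cost g v
  cost-mono (τ ξ ζ) (p ∷ q ∷ []) = *-mono-≤ (s≤s p) (s≤s q)
  cost-mono (δ ξ) (p ∷ []) = *-mono-≤ (s≤s p) (s≤s p)
  cost-mono (ε ξ) (p ∷ []) = s≤s p
  cost-mono (con γ) p = z≤n
  cost-mono (fun φ) p = z≤n

  wireWeight : Interpretation S
  wireWeight = record { out = out ; cost = cost ; out-mono = out-mono ; cost-mono = cost-mono }

  open Interpretation wireWeight using (⟦_⟧*; ⟦_⟧c)
  open Semantics wireWeight
  open SwapDuplicate wireWeight (λ _ _ _ _ → refl) (λ _ _ → refl)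

  ⟦τ[]⟧c : ∀ x ζ (u : NV x) (j : ℕ) → ⟦ τ[ x , ζ ] ⟧c (u ++ᵛ (j ∷ [])) ≡ weight u * suc j
  ⟦τ[]⟧c [] ζ [] j = refl
  ⟦τ[]⟧c (ξ ∷ x) ζ (i ∷ u) j rewrite ⟦τ[]⟧* x ζ u j | ⟦τ[]⟧c x ζ u j = distrib (weight u) i j
    where distrib : ∀ w i j → (0 + w * suc j) + (suc i * suc j + 0) ≡ (suc i + w) * suc j
          distrib = solve-∀

  ⟦τ⟨⟩⟧c : ∀ ζ x (j : ℕ) (u : NV x) → ⟦ τ⟨ ζ , x ⟩ ⟧c (j ∷ u) ≡ suc j * weight u
  ⟦τ⟨⟩⟧c ζ [] j [] = sym (*-zeroʳ (suc j))
  ⟦τ⟨⟩⟧c ζ (ξ ∷ x) j (i ∷ u) rewrite ⟦τ⟨⟩⟧c ζ x j u = distrib (weight u) i j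
    where distrib : ∀ w i j → (suc j * suc i + 0) + (0 + suc j * w) ≡ suc j * (suc i + w)
          distrib = solve-∀

  ⟦ε[]⟧c : ∀ x (u : NV x) → ⟦ ε[ x ] ⟧c u ≡ weight u
  ⟦ε[]⟧c [] [] = refl
  ⟦ε[]⟧c (ξ ∷ x) (i ∷ u) = cong (suc i +_) (⟦ε[]⟧c x u)

  ⟦δ[]⟧c : ∀ x (u : NV x) → ⟦ δ[ x ] ⟧c u ≤ weight u * weight u
  ⟦δ[]⟧c [] [] = z≤n
  ⟦δ[]⟧c (ξ ∷ x) (i ∷ u)
    rewrite ⟦δ[]⟧* x u | ⟦subst⟧c (++-assoc x [ ξ ] x) (τ⟨ ξ , x ⟩ ⋆₀ idT x) (i ∷ (u ++ᵛ u))
          | splitᵛ-++ᵛ x u u | ⟦τ⟨⟩⟧c ξ x i u = begin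
      (suc i * suc i + ⟦ δ[ x ] ⟧c u) + (0 + (suc i * w + 0))
        ≤⟨ +-monoˡ-≤ _ (+-monoʳ-≤ (suc i * suc i) (⟦δ[]⟧c x u)) ⟩
      (suc i * suc i + w * w) + (0 + (suc i * w + 0))
        ≤⟨ m≤m+n _ (w * suc i) ⟩
      (suc i * suc i + w * w) + (0 + (suc i * w + 0)) + w * suc i
        ≡⟨ square (suc i) w ⟩
      (suc i + w) * (suc i + w) ∎
    where
      w = weight u
      open ≤-Reasoning
      square : ∀ a w → (a * a + w * w) + (0 + (a * w + 0)) + w * a ≡ (a + w) * (a + w)
      square = solve-∀

  τˡ-≺ : ∀ {x ξ} (γ : Con x ξ) (ζ : Sort) → τˡ-target γ ζ ≺ τˡ-source γ ζ
  τˡ-≺ γ ζ .out-≤ = ≤ᵛ-reflexive ∘ τˡ-same-out γ ζ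
  τˡ-≺ {x} γ ζ .cost-< v with splitView x v
  ... | split u (j ∷ []) rewrite splitᵛ-++ᵛ x {[ ζ ]} u (j ∷ []) | ⟦τ[]⟧c x ζ u j = begin-strict
    weight u * suc j + 0                    <⟨ m<m+n _ z<s ⟩
    weight u * suc j + 0 + suc (j + suc j)  ≡⟨ expand (weight u) j ⟩
    suc (suc (weight u)) * suc j            ∎
    where
      open ≤-Reasoning
      expand : ∀ w j → w * suc j + 0 + suc (j + suc j) ≡ suc (suc w) * suc j
      expand = solve-∀

  τʳ-≺ : ∀ {x ξ} (γ : Con x ξ) (ζ : Sort) → τʳ-target γ ζ ≺ τʳ-source γ ζ
  τʳ-≺ γ ζ .out-≤ = ≤ᵛ-reflexive ∘ τʳ-same-out γ ζ
  τʳ-≺ {x} γ ζ .cost-< (j ∷ u) rewrite ⟦τ⟨⟩⟧c ζ x j u = begin-strict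
    suc j * weight u + 0                    <⟨ m<m+n _ z<s ⟩
    suc j * weight u + 0 + suc (j + suc j)  ≡⟨ expand (weight u) j ⟩
    suc j * suc (suc (weight u))            ∎
    where
      open ≤-Reasoning
      expand : ∀ w j → suc j * w + 0 + suc (j + suc j) ≡ suc j * suc (suc w)
      expand = solve-∀

  δ-≺ : ∀ {x ξ} (γ : Con x ξ) → δ-target γ ≺ δ-source γ
  δ-≺ γ .out-≤ = ≤ᵛ-reflexive ∘ δ-same-out γ
  δ-≺ {x} γ .cost-< u = begin-strict
    ⟦ δ[ x ] ⟧c u + 0                                 ≤⟨ +-monoˡ-≤ 0 (⟦δ[]⟧c x u) ⟩
    weight u * weight u + 0                           <⟨ m<m+n _ z<s ⟩
    weight u * weight u + 0 + suc (4 * weight u + 3)  ≡⟨ expand (weight u) ⟩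
    suc (suc (weight u)) * suc (suc (weight u))       ∎
    where
      open ≤-Reasoning
      expand : ∀ w → w * w + 0 + suc (4 * w + 3) ≡ suc (suc w) * suc (suc w)
      expand = solve-∀

  ε-≺ : ∀ {x ξ} (γ : Con x ξ) → ε-target γ ≺ ε-source γ
  ε-≺ γ .out-≤ = ≤ᵛ-reflexive ∘ ε-same-out γ
  ε-≺ {x} γ .cost-< u rewrite ⟦ε[]⟧c x u = <-trans (n<1+n (weight u)) (n<1+n (suc (weight u)))

module _ {A : Set} {_⊏_ : A → A → Set} where

  acc⇒noDescent : (f : ℕ → A) → Acc _⊏_ (f 0) → ¬ (∀ n → f (suc n) ⊏ f n)
  acc⇒noDescent f (acc rs) descent = acc⇒noDescent (f ∘ suc) (rs (descent 0)) (descent ∘ suc)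

  wellFounded⇒noDescent : WellFounded _⊏_ → (f : ℕ → A) → ¬ (∀ n → f (suc n) ⊏ f n)
  wellFounded⇒noDescent wf f = acc⇒noDescent f (wf (f 0))

infix 4 _<ₗₑₓ_

_<ₗₑₓ_ : ℕ × ℕ → ℕ × ℕ → Set
_<ₗₑₓ_ = ×-Lex _≡_ _<_ _<_

<ₗₑₓ-wellFounded : WellFounded _<ₗₑₓ_
<ₗₑₓ-wellFounded = ×-wellFounded <-wellFounded <-wellFounded

≤×<⇒<ₗₑₓ : ∀ {a b a′ b′} → a′ ≤ a → b′ < b → (a′ , b′) <ₗₑₓ (a , b)
≤×<⇒<ₗₑₓ a′≤a b′<b with m≤n⇒m<n∨m≡n a′≤a
... | inj₁ a′<a = inj₁ a′<a
... | inj₂ a′≡a = inj₂ (a′≡a , b′<b)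

module Termination (P : Program) (simple : SimpleProgram P) where
  open Program P
  open Signature sig
  open SimpleProgram simple
  open SimpleInterpretation interp-simple using (τˡ-≼; τʳ-≼; δ-≼; ε-≼)
  open WireWeight sig using (τˡ-≺; τʳ-≺; δ-≺; ε-≺)
  module I = Semantics interp
  module W = Semantics (WireWeight.wireWeight sig)
  open Interpretation interp using () renaming (⟦_⟧c to ⟦_⟧ᴵ)
  open Interpretation (WireWeight.wireWeight sig) using () renaming (⟦_⟧c to ⟦_⟧ᵂ)

  measure : ∀ {p q} → Term sig p q → ℕ × ℕ
  measure {p} f = ⟦ f ⟧ᴵ (zerosᵛ p) , ⟦ f ⟧ᵂ (zerosᵛ p)

  measure-resp-≈ : ∀ {p q} {f g : Term sig p q} → _≈_ sig f g → measure f ≡ measure g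
  measure-resp-≈ f≈g = cong₂ _,_ (proj₂ (I.⟦⟧-resp-≈ f≈g refl)) (proj₂ (W.⟦⟧-resp-≈ f≈g refl))

  cell-decreases : ∀ {a b} {s t : Term sig a b} → Cell3 P s t → t I.≺ s ⊎ (t I.≼ s × t W.≺ s)
  cell-decreases (τ-left γ ζ) = inj₂ (τˡ-≼ γ ζ , τˡ-≺ γ ζ)
  cell-decreases (τ-right γ ζ) = inj₂ (τʳ-≼ γ ζ , τʳ-≺ γ ζ)
  cell-decreases (δ-cell γ) = inj₂ (δ-≼ γ , δ-≺ γ)
  cell-decreases (ε-cell γ) = inj₂ (ε-≼ γ , ε-≺ γ)
  cell-decreases (comp r) =
    inj₁ record { out-≤ = proj₁ ∘ interp-compat r ; cost-< = proj₂ ∘ interp-compat r }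

  inContext-decreases : ∀ {p q a b} (x y : List Sort)
                        (h : Term sig p (x ++ (a ++ y))) (k : Term sig (x ++ (b ++ y)) q) {s t : Term sig a b} →
                        Cell3 P s t → measure (inContext x y h k t) <ₗₑₓ measure (inContext x y h k s)
  inContext-decreases x y h k c with cell-decreases c
  ... | inj₁ t≺s = inj₁ (I.cost-< (I.inContext-mono-≺ x y h k t≺s) _)
  ... | inj₂ (t≼s , t≺ʷs) =
    ≤×<⇒<ₗₑₓ (I.cost-≤ (I.inContext-mono-≼ x y h k t≼s) _)
              (W.cost-< (W.inContext-mono-≺ x y h k t≺ʷs) _)

  step-decreases : ∀ {p q} {f g : Term sig p q} → _⇛_ P f g → measure g <ₗₑₓ measure f
  step-decreases (step {x} {y} c h k f≈C[s] g≈C[t]) =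
    subst₂ _<ₗₑₓ_ (sym (measure-resp-≈ g≈C[t])) (sym (measure-resp-≈ f≈C[s]))
                  (inContext-decreases x y h k c)

theorem3p6 : (P : Program) → SimpleProgram P → Terminates P
theorem3p6 P simple f descent =
  wellFounded⇒noDescent <ₗₑₓ-wellFounded (measure ∘ f) (step-decreases ∘ descent)
  where open Termination P simple
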